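{- For integers $d\ge 0$ and $n\ge 0$, let $B_d(n)=|\Pi_d(n)|$, and set $B_d(m)=1$ for all integers $m\le 1$. Then for every $n\ge 1$, $$B_d(n)=\sum_{k=0}^{n-1}\binom{n-1}{k}B_d(k-d).$$ Furthermore, for every fixed $n\ge 1$, $B_d(n)=2^{n-1}$ for all sufficiently large $d$ (in particular $B_d(n)\to 2^{n-1}$ as $d\to\infty$).
   Context: A partition of $[n]=\{1,\dots,n\}$ is written $B_1/B_2/\cdots/B_k$ with its blocks ordered by increasing minimum elements. For $d\ge 0$, $\Pi_d(n)$ denotes the set of partitions $B_1/\cdots/B_k$ of $[n]$ such that for every $1<i<k$, the block $B_i$ contains at least $d$ elements larger than $\max B_{i+1}$, i.e. $|\{x\in B_i : x>\max B_{i+1}\}|\ge d$. (For $d=0$ this is the set of all partitions, so $B_0(n)$ is the Bell number.) -}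

module Defs where

open import Data.Nat as ℕ using (ℕ; zero; suc; _≤_; _<_; _≤ᵇ_; _<ᵇ_; _+_; _*_; _∸_)
open import Data.Nat.Combinatorics using (_C_)
open import Data.Bool using (Bool; if_then_else_)
open import Data.Fin as Fin using (Fin; toℕ)
open import Data.Fin.Subset using (Subset; _∈_; _∩_; ∣_∣; Nonempty)
open import Data.Vec using (tabulate)
open import Data.List using (List; length; lookup; map; upTo)
open import Data.Nat.ListAction using (sum)
open import Data.List.Membership.Propositional using () renaming (_∈_ to _∈ₗ_)
open import Data.List.Relation.Unary.Unique.Propositional using (Unique)
open import Data.Product using (Σ; _×_)
open import Relation.Binary.PropositionalEquality using (_≡_)
open import Function.Bundles using (_⇔_)

-- A block of a partition of [n] is a subset of Fin n (element i of Fin n stands for i+1).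
-- m is the minimum / maximum of block b.
IsMin : ∀ {n} → Subset n → Fin n → Set
IsMin b m = m ∈ b × (∀ y → y ∈ b → toℕ m ≤ toℕ y)

IsMax : ∀ {n} → Subset n → Fin n → Set
IsMax b m = m ∈ b × (∀ y → y ∈ b → toℕ y ≤ toℕ m)

record IsPartition (n : ℕ) (bs : List (Subset n)) : Set where
  field
    nonempty : ∀ i → Nonempty (lookup bs i)
    covers   : ∀ x → Σ (Fin (length bs)) λ i → x ∈ lookup bs i
    disjoint : ∀ i j x → x ∈ lookup bs i → x ∈ lookup bs j → i ≡ j
    ordered  : ∀ i j → toℕ i < toℕ j → ∀ mi mj →
               IsMin (lookup bs i) mi → IsMin (lookup bs j) mj → toℕ mi < toℕ mj

above : ∀ {n} → Fin n → Subset n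
above M = tabulate λ x → toℕ M <ᵇ toℕ x

-- Π_d(n): for every 1 < i < k (1-indexed), B_i has at least d elements larger
-- than max B_{i+1}.  In 0-indexed terms: positions i with 1 ≤ i and i+1 < k.
record InΠ (d n : ℕ) (bs : List (Subset n)) : Set where
  field
    partition : IsPartition n bs
    condition : ∀ (i j : Fin (length bs)) → 1 ≤ toℕ i → toℕ j ≡ suc (toℕ i) →
                ∀ M → IsMax (lookup bs j) M → d ≤ ∣ lookup bs i ∩ above M ∣

IsCount : {A : Set} → (A → Set) → ℕ → Set
IsCount {A} P c = Σ (List A) λ L → Unique L × (∀ x → (x ∈ₗ L) ⇔ P x) × length L ≡ c

-- Extension of B_d to integers m = k - d:  B_d(m) = 1 for m ≤ 1, i.e. k ≤ d + 1;
-- otherwise B_d(k - d) with k - d a natural number.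
Bext : (ℕ → ℕ) → ℕ → ℕ → ℕ
Bext Bd d k = if k ≤ᵇ suc d then 1 else Bd (k ∸ d)

recSum : (ℕ → ℕ) → ℕ → ℕ → ℕ
recSum Bd d n = sum (map (λ k → ((n ∸ 1) C k) * Bext Bd d k) (upTo n))

-- Deleting the block B₁ ∋ 1 of a partition in Π_d(n) leaves, with S = B₁ ∖ {1}, a partition of
-- {2,…,n} ∖ S in which every block, the first one included, has at least d elements above
-- the maximum of the next block. Relabelling {2,…,n} ∖ S increasingly as [k] (k = n − 1 − |S|),
-- such partitions are counted by B_d(k − d): for k ≤ d + 1 only the partition with at most one block
-- qualifies, and otherwise the top d elements all lie in the first block, and deleting them is a
-- bijection onto Π_d(k − d). Summing over S gives Σ_k C(n−1,k) B_d(k − d). For d ≥ n − 1 every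
-- term has k ≤ d + 1, so B_d(n) = Σ_k C(n−1,k) = 2^(n−1).

module Submission where

open import Defs
open import Data.Bool using (Bool; true; false; _∧_; if_then_else_)
open import Data.Bool.Properties using (∧-zeroʳ; T-≡; ¬-not)
open import Data.Empty using (⊥-elim)
open import Data.Fin using (Fin; zero; suc; toℕ; _↑ˡ_; _↑ʳ_; splitAt)
open import Data.Fin.Properties using (toℕ-injective; toℕ<n; toℕ-↑ˡ; toℕ-↑ʳ; splitAt⁻¹-↑ˡ; splitAt⁻¹-↑ʳ)
open import Data.Fin.Subset using (Subset; _∈_; _∉_; _⊆_; _∩_; ∣_∣; ∁; ⊤; ⊥; Nonempty)
open import Data.Fin.Subset.Properties
  using (∈⊤; ∉⊥; ⊆⊤; ⊆-antisym; nonempty?; _∈?_; x∈∁p⇒x∉p; x∉p⇒x∈∁p; ∩-identityʳ; ∣⊤∣≡n; ∣⊥∣≡0; Empty-unique; ∣p∩q∣≤∣q∣)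
open import Data.List as List using (List; []; _∷_; upTo; applyUpTo)
open import Data.List.Properties as List using (map-++; map-∘; length-map; length-++; map-injective; map-id-local)
open import Data.List.Membership.Propositional using () renaming (_∈_ to _∈ₗ_)
open import Data.List.Membership.Propositional.Properties using (∈-map⁺; ∈-map⁻; ∈-++⁺ˡ; ∈-++⁺ʳ; ∈-++⁻)
open import Data.List.Membership.Propositional.Properties.WithK using (unique∧set⇒bag)
open import Data.List.Relation.Binary.BagAndSetEquality using (∼bag⇒↭)
open import Data.List.Relation.Binary.Permutation.Propositional.Properties using (↭-length)
open import Data.List.Relation.Unary.All as All using (All; []; _∷_)
open import Data.List.Relation.Unary.All.Properties as All using (All¬⇒¬Any)
open import Data.List.Relation.Unary.AllPairs as AllPairs using (AllPairs; []; _∷_)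
import Data.List.Relation.Unary.AllPairs.Properties as AllPairs
open import Data.List.Relation.Unary.Any as Any using (Any; here; there)
open import Data.List.Relation.Unary.Any.Properties as Any using (lookup-index)
open import Data.List.Relation.Unary.Linked as Linked using (Linked; []; [-]; _∷_)
import Data.List.Relation.Unary.Linked.Properties as Linked
open import Data.List.Relation.Unary.Unique.Propositional using (Unique)
import Data.List.Relation.Unary.Unique.Propositional.Properties as Unique
open import Data.Nat using (ℕ; zero; suc; _+_; _*_; _∸_; _^_; _≤_; _<_; _≤?_; s≤s; z≤n; s≤s⁻¹)
open import Data.Nat.Combinatorics using (_C_; nCn≡1; nCk≡nC[n∸k]; nCk+nC[k+1]≡[n+1]C[k+1])
open import Data.Nat.Combinatorics.Specification using (k>n⇒nCk≡0)
open import Data.Nat.ListAction using (sum)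
open import Data.Nat.ListAction.Properties using (sum-++)
open import Data.Nat.Properties
open import Algebra.Properties.CommutativeSemigroup +-commutativeSemigroup using (interchange; x∙yz≈xz∙y)
open import Data.Product using (Σ; _×_; _,_; proj₁; proj₂)
open import Data.Sum using (_⊎_; inj₁; inj₂)
open import Data.Vec as Vec using ([]; _∷_; _++_; here; there; allFin; take; drop)
open import Data.Vec.Properties as Vec using (tabulate-allFin; map-const; zipWith-++; take++drop≡id; ++-injectiveˡ)
open import Function using (_∘_; const)
open import Function.Bundles using (mk⇔; Equivalence)
open Equivalence using (to; from)
open import Relation.Binary.Definitions using (tri<; tri≈; tri>)
open import Relation.Binary.PropositionalEquality
open import Relation.Nullary using (¬_; yes; no; contraposition)

-- Binomial sums

∑< : ℕ → (ℕ → ℕ) → ℕ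
∑< zero    f = 0
∑< (suc n) f = f 0 + ∑< n (f ∘ suc)

sum-map-applyUpTo : ∀ n (f h : ℕ → ℕ) → sum (List.map f (applyUpTo h n)) ≡ ∑< n (f ∘ h)
sum-map-applyUpTo zero    f h = refl
sum-map-applyUpTo (suc n) f h = cong (f (h 0) +_) (sum-map-applyUpTo n f (h ∘ suc))

sum-map-upTo : ∀ n (f : ℕ → ℕ) → sum (List.map f (upTo n)) ≡ ∑< n f
sum-map-upTo n f = sum-map-applyUpTo n f (λ k → k)

∑<-cong : ∀ n {f g : ℕ → ℕ} → (∀ k → k < n → f k ≡ g k) → ∑< n f ≡ ∑< n g
∑<-cong zero    eq = refl
∑<-cong (suc n) eq = cong₂ _+_ (eq 0 (s≤s z≤n)) (∑<-cong n (λ k k<n → eq (suc k) (s≤s k<n)))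

∑<-+ : ∀ n (f g : ℕ → ℕ) → ∑< n (λ k → f k + g k) ≡ ∑< n f + ∑< n g
∑<-+ zero    f g = refl
∑<-+ (suc n) f g = trans (cong (f 0 + g 0 +_) (∑<-+ n (f ∘ suc) (g ∘ suc)))
                         (interchange (f 0) (g 0) (∑< n (f ∘ suc)) (∑< n (g ∘ suc)))

∑<-snoc : ∀ n (f : ℕ → ℕ) → ∑< (suc n) f ≡ ∑< n f + f n
∑<-snoc zero    f = +-comm (f 0) 0
∑<-snoc (suc n) f = trans (cong (f 0 +_) (∑<-snoc n (f ∘ suc))) (sym (+-assoc (f 0) _ _))

nC0≡1 : ∀ n → n C 0 ≡ 1
nC0≡1 n = trans (nCk≡nC[n∸k] {0} {n} z≤n) (nCn≡1 n)

binomialSum : ℕ → (ℕ → ℕ) → ℕ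
binomialSum n g = ∑< (suc n) (λ k → (n C k) * g k)

binomialSum-extend : ∀ n g → binomialSum n g ≡ ∑< (suc (suc n)) (λ k → (n C k) * g k)
binomialSum-extend n g = sym (begin
  ∑< (suc (suc n)) (λ k → (n C k) * g k)     ≡⟨ ∑<-snoc (suc n) (λ k → (n C k) * g k) ⟩
  binomialSum n g + (n C suc n) * g (suc n)   ≡⟨ cong (λ c → binomialSum n g + c * g (suc n)) (k>n⇒nCk≡0 {n} {suc n} ≤-refl) ⟩
  binomialSum n g + 0                         ≡⟨ +-identityʳ _ ⟩
  binomialSum n g                             ∎)
  where open ≡-Reasoning

binomialSum-suc : ∀ n g → binomialSum (suc n) g ≡ binomialSum n g + binomialSum n (g ∘ suc)
binomialSum-suc n g = begin
  (suc n C 0) * g 0 + ∑< (suc n) (λ k → (suc n C suc k) * g (suc k))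
    ≡⟨ cong₂ _+_ (cong (_* g 0) (trans (nC0≡1 (suc n)) (sym (nC0≡1 n)))) (∑<-cong (suc n) pascal) ⟩
  (n C 0) * g 0 + ∑< (suc n) (λ k → (n C k) * g (suc k) + (n C suc k) * g (suc k))
    ≡⟨ cong ((n C 0) * g 0 +_) (∑<-+ (suc n) (λ k → (n C k) * g (suc k)) (λ k → (n C suc k) * g (suc k))) ⟩
  (n C 0) * g 0 + (binomialSum n (g ∘ suc) + ∑< (suc n) (λ k → (n C suc k) * g (suc k)))
    ≡⟨ x∙yz≈xz∙y ((n C 0) * g 0) (binomialSum n (g ∘ suc)) _ ⟩
  ∑< (suc (suc n)) (λ k → (n C k) * g k) + binomialSum n (g ∘ suc)
    ≡⟨ cong (_+ binomialSum n (g ∘ suc)) (sym (binomialSum-extend n g)) ⟩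
  binomialSum n g + binomialSum n (g ∘ suc) ∎
  where
  open ≡-Reasoning
  pascal : ∀ k → k < suc n → (suc n C suc k) * g (suc k) ≡ (n C k) * g (suc k) + (n C suc k) * g (suc k)
  pascal k _ = trans (cong (_* g (suc k)) (sym (nCk+nC[k+1]≡[n+1]C[k+1] n k))) (*-distribʳ-+ (g (suc k)) (n C k) _)

binomialSum-cong : ∀ n {g h : ℕ → ℕ} → (∀ k → k ≤ n → g k ≡ h k) → binomialSum n g ≡ binomialSum n h
binomialSum-cong n g≗h = ∑<-cong (suc n) λ k k<1+n → cong ((n C k) *_) (g≗h k (s≤s⁻¹ k<1+n))

binomialSum-one : ∀ n → binomialSum n (const 1) ≡ 2 ^ n
binomialSum-one zero    = refl
binomialSum-one (suc n) = begin
  binomialSum (suc n) (const 1)                       ≡⟨ binomialSum-suc n (const 1) ⟩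
  binomialSum n (const 1) + binomialSum n (const 1)   ≡⟨ cong₂ _+_ (binomialSum-one n) (binomialSum-one n) ⟩
  2 ^ n + 2 ^ n                                       ≡⟨ cong (2 ^ n +_) (sym (+-identityʳ (2 ^ n))) ⟩
  2 ^ suc n                                           ∎
  where open ≡-Reasoning

allSubsets : (n : ℕ) → List (Subset n)
allSubsets zero    = [] ∷ []
allSubsets (suc n) = List.map (true ∷_) (allSubsets n) List.++ List.map (false ∷_) (allSubsets n)

∈-allSubsets : ∀ {n} (s : Subset n) → s ∈ₗ allSubsets n
∈-allSubsets []          = here refl
∈-allSubsets (true ∷ s)  = ∈-++⁺ˡ (∈-map⁺ (true ∷_) (∈-allSubsets s))
∈-allSubsets (false ∷ s) = ∈-++⁺ʳ _ (∈-map⁺ (false ∷_) (∈-allSubsets s))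

allSubsets-unique : ∀ n → Unique (allSubsets n)
allSubsets-unique zero    = [] ∷ []
allSubsets-unique (suc n) =
  Unique.++⁺ (Unique.map⁺ Vec.∷-injectiveʳ (allSubsets-unique n))
             (Unique.map⁺ Vec.∷-injectiveʳ (allSubsets-unique n)) heads-differ
  where
  heads-differ : ∀ {v} → ¬ (v ∈ₗ List.map (true ∷_) (allSubsets n) × v ∈ₗ List.map (false ∷_) (allSubsets n))
  heads-differ (p , q) with ∈-map⁻ (true ∷_) p | ∈-map⁻ (false ∷_) q
  ... | _ , _ , refl | _ , _ , ()

-- Grouping the subsets by their first entry is Pascal's rule.
sum-allSubsets : ∀ n (g : ℕ → ℕ) → sum (List.map (g ∘ ∣_∣ ∘ ∁) (allSubsets n)) ≡ binomialSum n g
sum-allSubsets zero    g = cong (_+ 0) (sym (+-identityʳ (g 0)))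
sum-allSubsets (suc n) g = begin
  sum (List.map G (List.map (true ∷_) (allSubsets n) List.++ List.map (false ∷_) (allSubsets n)))
    ≡⟨ cong sum (map-++ G (List.map (true ∷_) (allSubsets n)) _) ⟩
  sum (List.map G (List.map (true ∷_) (allSubsets n)) List.++ List.map G (List.map (false ∷_) (allSubsets n)))
    ≡⟨ sum-++ (List.map G (List.map (true ∷_) (allSubsets n))) _ ⟩
  sum (List.map G (List.map (true ∷_) (allSubsets n))) + sum (List.map G (List.map (false ∷_) (allSubsets n)))
    ≡⟨ cong₂ _+_ (cong sum (sym (map-∘ (allSubsets n)))) (cong sum (sym (map-∘ (allSubsets n)))) ⟩
  sum (List.map G (allSubsets n)) + sum (List.map (g ∘ suc ∘ ∣_∣ ∘ ∁) (allSubsets n))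
    ≡⟨ cong₂ _+_ (sum-allSubsets n g) (sum-allSubsets n (g ∘ suc)) ⟩
  binomialSum n g + binomialSum n (g ∘ suc)
    ≡⟨ sym (binomialSum-suc n g) ⟩
  binomialSum (suc n) g ∎
  where
  open ≡-Reasoning
  G : ∀ {m} → Subset m → ℕ
  G = g ∘ ∣_∣ ∘ ∁

-- Counting

module _ {A B : Set} {P : A → Set} {Q : B → Set} where

  IsCount-transport : ∀ {c} → IsCount P c → (f : A → B) (g : B → A) →
                      (∀ x → P x → Q (f x)) → (∀ y → Q y → P (g y)) →
                      (∀ x → g (f x) ≡ x) → (∀ y → Q y → f (g y) ≡ y) → IsCount Q c
  IsCount-transport (L , unique , members , length≡c) f g P⇒Q Q⇒P gf fg =
    List.map f L , Unique.map⁺ f-injective unique , (λ y → mk⇔ (image⇒Q y) (Q⇒image y)) ,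
    trans (length-map f L) length≡c
    where
    f-injective : ∀ {x x′} → f x ≡ f x′ → x ≡ x′
    f-injective {x} {x′} eq = trans (sym (gf x)) (trans (cong g eq) (gf x′))
    image⇒Q : ∀ y → y ∈ₗ List.map f L → Q y
    image⇒Q y y∈ with ∈-map⁻ f y∈
    ... | x , x∈ , refl = P⇒Q x (to (members x) x∈)
    Q⇒image : ∀ y → Q y → y ∈ₗ List.map f L
    Q⇒image y q = subst (_∈ₗ List.map f L) (fg y q) (∈-map⁺ f (from (members (g y)) (Q⇒P y q)))

module _ {A : Set} {P : A → Set} where

  IsCount-unique : ∀ {a b} → IsCount P a → IsCount P b → a ≡ b
  IsCount-unique (L₁ , u₁ , m₁ , refl) (L₂ , u₂ , m₂ , refl) =
    ↭-length (∼bag⇒↭ (unique∧set⇒bag u₁ u₂ λ {x} →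
      mk⇔ (from (m₂ x) ∘ to (m₁ x)) (from (m₁ x) ∘ to (m₂ x))))

  IsCount-⇔ : ∀ {Q : A → Set} {c} → IsCount P c → (∀ x → P x → Q x) → (∀ x → Q x → P x) → IsCount Q c
  IsCount-⇔ count P⇒Q Q⇒P = IsCount-transport count (λ x → x) (λ x → x) P⇒Q Q⇒P (λ _ → refl) (λ _ _ → refl)

module _ {K A B : Set} (Q : K → A → Set) (build : K → A → B) where

  Built : List K → B → Set
  Built Ks y = Σ K λ k → k ∈ₗ Ks × Σ A λ a → Q k a × y ≡ build k a

  module _ (c : K → ℕ) (count : ∀ k → IsCount (Q k) (c k))
           (build-injectiveˡ : ∀ {k k′ a a′} → build k a ≡ build k′ a′ → k ≡ k′)
           (build-injectiveʳ : ∀ {k a a′} → build k a ≡ build k a′ → a ≡ a′) where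

    IsCount-Built : ∀ Ks → Unique Ks → IsCount (Built Ks) (sum (List.map c Ks))
    IsCount-Built [] _ = [] , [] , (λ y → mk⇔ (λ ()) (λ { (_ , () , _) })) , refl
    IsCount-Built (k ∷ Ks) (k∉Ks ∷ unique) with count k | IsCount-Built Ks unique
    ... | (L , uL , mL , ∣L∣) | (R , uR , mR , ∣R∣) =
      List.map (build k) L List.++ R ,
      Unique.++⁺ (Unique.map⁺ build-injectiveʳ uL) uR disjoint ,
      (λ y → mk⇔ (⇒Built y) (Built⇒ y)) ,
      trans (length-++ (List.map (build k) L)) (cong₂ _+_ (trans (length-map (build k) L) ∣L∣) ∣R∣)
      where
      disjoint : ∀ {y} → ¬ (y ∈ₗ List.map (build k) L × y ∈ₗ R)
      disjoint (y∈L , y∈R) with ∈-map⁻ (build k) y∈L | to (mR _) y∈R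
      ... | a , _ , refl | k′ , k′∈Ks , _ , _ , eq =
        All¬⇒¬Any k∉Ks (subst (_∈ₗ Ks) (sym (build-injectiveˡ eq)) k′∈Ks)
      ⇒Built : ∀ y → y ∈ₗ List.map (build k) L List.++ R → Built (k ∷ Ks) y
      ⇒Built y y∈ with ∈-++⁻ (List.map (build k) L) y∈
      ... | inj₁ y∈L with ∈-map⁻ (build k) y∈L
      ...   | a , a∈L , eq = k , here refl , a , to (mL a) a∈L , eq
      ⇒Built y y∈ | inj₂ y∈R with to (mR y) y∈R
      ...   | k′ , k′∈Ks , a , q , eq = k′ , there k′∈Ks , a , q , eq
      Built⇒ : ∀ y → Built (k ∷ Ks) y → y ∈ₗ List.map (build k) L List.++ R
      Built⇒ y (_ , here refl , a , q , refl) = ∈-++⁺ˡ (∈-map⁺ (build k) (from (mL a) q))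
      Built⇒ y (k′ , there k′∈Ks , a , q , eq) = ∈-++⁺ʳ (List.map (build k) L) (from (mR y) (k′ , k′∈Ks , a , q , eq))

-- Partitions as lists of blocks

Disjoint : ∀ {n} → Subset n → Subset n → Set
Disjoint a b = ∀ {x} → x ∈ a → x ∉ b

MinBefore : ∀ {n} → Subset n → Subset n → Set
MinBefore a b = ∀ ma mb → IsMin a ma → IsMin b mb → toℕ ma < toℕ mb

AboveMax : ∀ {n} → ℕ → Subset n → Subset n → Set
AboveMax d a b = ∀ M → IsMax b M → d ≤ ∣ a ∩ above M ∣

record Partition {n} (u : Subset n) (bs : List (Subset n)) : Set where
  constructor mkPartition
  field
    nonempty : All Nonempty bs
    ⊆u       : All (_⊆ u) bs
    covers   : ∀ {x} → x ∈ u → Any (x ∈_) bs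
    disjoint : AllPairs Disjoint bs
    ordered  : AllPairs MinBefore bs

ListΠ : ℕ → (n : ℕ) → List (Subset n) → Set
ListΠ d n bs = Partition ⊤ bs × Linked (AboveMax d) (List.drop 1 bs)

StrictΠ : ∀ {n} → ℕ → Subset n → List (Subset n) → Set
StrictΠ d u bs = Partition u bs × Linked (AboveMax d) bs

module _ {A : Set} where

  All⇐lookup : {P : A → Set} (xs : List A) → (∀ i → P (List.lookup xs i)) → All P xs
  All⇐lookup []       p = []
  All⇐lookup (x ∷ xs) p = p zero ∷ All⇐lookup xs (p ∘ suc)

  All⇒lookup : {P : A → Set} {xs : List A} → All P xs → ∀ i → P (List.lookup xs i)
  All⇒lookup (p ∷ ps) zero    = p
  All⇒lookup (p ∷ ps) (suc i) = All⇒lookup ps i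

  Any⇐lookup : {P : A → Set} (xs : List A) → Σ (Fin (List.length xs)) (P ∘ List.lookup xs) → Any P xs
  Any⇐lookup (x ∷ xs) (zero , p)  = here p
  Any⇐lookup (x ∷ xs) (suc i , p) = there (Any⇐lookup xs (i , p))

  Any⇒lookup : {P : A → Set} {xs : List A} → Any P xs → Σ (Fin (List.length xs)) (P ∘ List.lookup xs)
  Any⇒lookup p = Any.index p , lookup-index p

  AllPairs⇐lookup : {R : A → A → Set} (xs : List A) →
                    (∀ i j → toℕ i < toℕ j → R (List.lookup xs i) (List.lookup xs j)) → AllPairs R xs
  AllPairs⇐lookup []       r = []
  AllPairs⇐lookup (x ∷ xs) r =
    All⇐lookup xs (λ j → r zero (suc j) (s≤s z≤n)) ∷ AllPairs⇐lookup xs (λ i j i<j → r (suc i) (suc j) (s≤s i<j))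

  AllPairs⇒lookup : {R : A → A → Set} {xs : List A} → AllPairs R xs →
                    ∀ i j → toℕ i < toℕ j → R (List.lookup xs i) (List.lookup xs j)
  AllPairs⇒lookup (r ∷ rs) zero    (suc j) _         = All⇒lookup r j
  AllPairs⇒lookup (r ∷ rs) (suc i) (suc j) (s≤s i<j) = AllPairs⇒lookup rs i j i<j

  Linked⇐lookup : {R : A → A → Set} (xs : List A) →
                  (∀ i j → toℕ j ≡ suc (toℕ i) → R (List.lookup xs i) (List.lookup xs j)) → Linked R xs
  Linked⇐lookup []           r = []
  Linked⇐lookup (x ∷ [])     r = [-]
  Linked⇐lookup (x ∷ y ∷ xs) r = r zero (suc zero) refl ∷ Linked⇐lookup (y ∷ xs) (λ i j eq → r (suc i) (suc j) (cong suc eq))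

  Linked⇒lookup : {R : A → A → Set} {xs : List A} → Linked R xs →
                  ∀ i j → toℕ j ≡ suc (toℕ i) → R (List.lookup xs i) (List.lookup xs j)
  Linked⇒lookup (r ∷ rs) zero    (suc zero)    _  = r
  Linked⇒lookup (r ∷ rs) (suc i) (suc j)       eq = Linked⇒lookup rs i j (suc-injective eq)

module _ {A : Set} {S : A → Set} where

  AllPairs-mapWith : {R T : A → A → Set} {xs : List A} → All S xs →
                     (∀ {x y} → S x → S y → R x y → T x y) → AllPairs R xs → AllPairs T xs
  AllPairs-mapWith []       f []       = []
  AllPairs-mapWith (s ∷ ss) f (r ∷ rs) = All.zipWith (λ (s′ , r′) → f s s′ r′) (ss , r) ∷ AllPairs-mapWith ss f rs

  Linked-mapWith : {R T : A → A → Set} {xs : List A} → All S xs →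
                   (∀ {x y} → S x → S y → R x y → T x y) → Linked R xs → Linked T xs
  Linked-mapWith _            f []       = []
  Linked-mapWith _            f [-]      = [-]
  Linked-mapWith (s ∷ s′ ∷ ss) f (r ∷ rs) = f s s′ r ∷ Linked-mapWith (s′ ∷ ss) f rs

InΠ⇒ListΠ : ∀ {d n bs} → InΠ d n bs → ListΠ d n bs
InΠ⇒ListΠ {d} {bs = bs} π =
  mkPartition (All⇐lookup bs nonempty) (All⇐lookup bs λ _ _ → ∈⊤) (λ {x} _ → Any⇐lookup bs (covers x))
              (AllPairs⇐lookup bs λ i j i<j x∈i x∈j → <-irrefl (cong toℕ (disjoint i j _ x∈i x∈j)) i<j)
              (AllPairs⇐lookup bs ordered) ,
  linkedTail bs (InΠ.condition π)
  where
  open IsPartition (InΠ.partition π)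
  linkedTail : ∀ bs → (∀ (i j : Fin (List.length bs)) → 1 ≤ toℕ i → toℕ j ≡ suc (toℕ i) →
                         AboveMax d (List.lookup bs i) (List.lookup bs j)) →
               Linked (AboveMax d) (List.drop 1 bs)
  linkedTail []       _    = []
  linkedTail (b ∷ bs) cond = Linked⇐lookup bs λ i j eq → cond (suc i) (suc j) (s≤s z≤n) (cong suc eq)

ListΠ⇒InΠ : ∀ {d n bs} → ListΠ d n bs → InΠ d n bs
ListΠ⇒InΠ {d} {bs = bs} (mkPartition nonempty _ covers disjoint ordered , linked) = record
  { partition = record
    { nonempty = All⇒lookup nonempty
    ; covers   = λ x → Any⇒lookup (covers ∈⊤)
    ; disjoint = sameBlock
    ; ordered  = AllPairs⇒lookup ordered
    }
  ; condition = conditionTail bs linked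
  }
  where
  sameBlock : ∀ i j x → x ∈ List.lookup bs i → x ∈ List.lookup bs j → i ≡ j
  sameBlock i j x x∈i x∈j with <-cmp (toℕ i) (toℕ j)
  ... | tri< i<j _ _ = ⊥-elim (AllPairs⇒lookup disjoint i j i<j x∈i x∈j)
  ... | tri≈ _ eq _  = toℕ-injective eq
  ... | tri> _ _ j<i = ⊥-elim (AllPairs⇒lookup disjoint j i j<i x∈j x∈i)
  conditionTail : ∀ bs → Linked (AboveMax d) (List.drop 1 bs) →
                  ∀ (i j : Fin (List.length bs)) → 1 ≤ toℕ i → toℕ j ≡ suc (toℕ i) →
                  AboveMax d (List.lookup bs i) (List.lookup bs j)
  conditionTail (b ∷ bs) linked (suc i) (suc j) _ eq = Linked⇒lookup linked i j (suc-injective eq)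

module _ {n : ℕ} where

  IsMin-unique : ∀ {b : Subset n} {x y} → IsMin b x → IsMin b y → x ≡ y
  IsMin-unique (x∈ , x≤) (y∈ , y≤) = toℕ-injective (≤-antisym (x≤ _ y∈) (y≤ _ x∈))

  IsMax-unique : ∀ {b : Subset n} {x y} → IsMax b x → IsMax b y → x ≡ y
  IsMax-unique (x∈ , ≤x) (y∈ , ≤y) = toℕ-injective (≤-antisym (≤y _ x∈) (≤x _ y∈))

Nonempty-false∷⁻ : ∀ {n} {s : Subset n} → Nonempty (false ∷ s) → Nonempty s
Nonempty-false∷⁻ (suc i , there i∈s) = i , i∈s

minimum : ∀ {n} (b : Subset n) → Nonempty b → Σ (Fin n) (IsMin b)
minimum (true ∷ s)  _  = zero , here , λ _ _ → z≤n
minimum (false ∷ s) ne with minimum s (Nonempty-false∷⁻ ne)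
... | m , m∈ , m≤ = suc m , there m∈ , λ { (suc y) (there y∈) → s≤s (m≤ y y∈) }

maximum : ∀ {n} (b : Subset n) → Nonempty b → Σ (Fin n) (IsMax b)
maximum (x ∷ s) ne with nonempty? s
... | yes ne-s with maximum s ne-s
...   | M , M∈ , ≤M = suc M , there M∈ , λ { zero _ → z≤n ; (suc y) (there y∈) → s≤s (≤M y y∈) }
maximum (true ∷ s)  _  | no ¬ne-s = zero , here , λ { zero _ → z≤n ; (suc y) (there y∈) → ⊥-elim (¬ne-s (y , y∈)) }
maximum (false ∷ s) ne | no ¬ne-s = ⊥-elim (¬ne-s (Nonempty-false∷⁻ ne))

module _ {n : ℕ} {a : Subset n} where

  IsMin-false∷⁺ : ∀ {m} → IsMin a m → IsMin (false ∷ a) (suc m)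
  IsMin-false∷⁺ (m∈ , m≤) = there m∈ , λ { (suc y) (there y∈) → s≤s (m≤ y y∈) }

  IsMin-false∷⁻ : ∀ {m} → IsMin (false ∷ a) (suc m) → IsMin a m
  IsMin-false∷⁻ (there m∈ , m≤) = m∈ , λ y y∈ → s≤s⁻¹ (m≤ (suc y) (there y∈))

  IsMax-false∷⁺ : ∀ {m} → IsMax a m → IsMax (false ∷ a) (suc m)
  IsMax-false∷⁺ (m∈ , ≤m) = there m∈ , λ { (suc y) (there y∈) → s≤s (≤m y y∈) }

  IsMax-false∷⁻ : ∀ {m} → IsMax (false ∷ a) (suc m) → IsMax a m
  IsMax-false∷⁻ (there m∈ , ≤m) = m∈ , λ y y∈ → s≤s⁻¹ (≤m (suc y) (there y∈))

module _ {n : ℕ} {a b : Subset n} where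

  Disjoint-false∷⁺ : Disjoint a b → Disjoint (false ∷ a) (false ∷ b)
  Disjoint-false∷⁺ a∩b=∅ (there x∈a) (there x∈b) = a∩b=∅ x∈a x∈b

  Disjoint-false∷⁻ : Disjoint (false ∷ a) (false ∷ b) → Disjoint a b
  Disjoint-false∷⁻ a∩b=∅ x∈a x∈b = a∩b=∅ (there x∈a) (there x∈b)

  MinBefore-false∷⁺ : MinBefore a b → MinBefore (false ∷ a) (false ∷ b)
  MinBefore-false∷⁺ a<b (suc ma) (suc mb) ma-min mb-min = s≤s (a<b ma mb (IsMin-false∷⁻ ma-min) (IsMin-false∷⁻ mb-min))
  MinBefore-false∷⁺ a<b zero     _        (() , _) _
  MinBefore-false∷⁺ a<b (suc _)  zero     _        (() , _)

  MinBefore-false∷⁻ : MinBefore (false ∷ a) (false ∷ b) → MinBefore a b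
  MinBefore-false∷⁻ a<b ma mb ma-min mb-min = s≤s⁻¹ (a<b (suc ma) (suc mb) (IsMin-false∷⁺ ma-min) (IsMin-false∷⁺ mb-min))

  AboveMax-false∷⁺ : ∀ {d} → AboveMax d a b → AboveMax d (false ∷ a) (false ∷ b)
  AboveMax-false∷⁺ above zero    (() , _)
  AboveMax-false∷⁺ above (suc M) M-max = above M (IsMax-false∷⁻ M-max)

  AboveMax-false∷⁻ : ∀ {d} → AboveMax d (false ∷ a) (false ∷ b) → AboveMax d a b
  AboveMax-false∷⁻ above M M-max = above (suc M) (IsMax-false∷⁺ M-max)

-- Removing the block of the least element

-- Holds because blocks are listed by increasing minima.
zero∈firstBlock : ∀ {n} {b : Subset (suc n)} {cs} → Partition ⊤ (b ∷ cs) → zero ∈ b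
zero∈firstBlock {b = b} (mkPartition (ne ∷ _) _ covers _ (b<cs ∷ _)) with covers {zero} ∈⊤
... | here 0∈b   = 0∈b
... | there 0∈cs = ⊥-elim (All.lookupWith 0∉laterBlock b<cs 0∈cs)
  where
  0∉laterBlock : ∀ {c} → MinBefore b c → zero ∉ c
  0∉laterBlock b<c 0∈c with minimum b ne
  ... | m , m-min = n≮0 (b<c m zero m-min (0∈c , λ _ _ → z≤n))

withFirstBlock : ∀ {n} → Subset n → List (Subset n) → List (Subset (suc n))
withFirstBlock s ts = (true ∷ s) ∷ List.map (false ∷_) ts

withFirstBlock-injectiveˡ : ∀ {n} {s s′ : Subset n} {ts ts′} → withFirstBlock s ts ≡ withFirstBlock s′ ts′ → s ≡ s′
withFirstBlock-injectiveˡ eq = Vec.∷-injectiveʳ (List.∷-injectiveˡ eq)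

withFirstBlock-injectiveʳ : ∀ {n} {s : Subset n} {ts ts′} → withFirstBlock s ts ≡ withFirstBlock s ts′ → ts ≡ ts′
withFirstBlock-injectiveʳ eq = map-injective Vec.∷-injectiveʳ (List.∷-injectiveʳ eq)

module _ {n : ℕ} where

  ∌zero⇒map-false∷ : (cs : List (Subset (suc n))) → All (zero ∉_) cs →
                     Σ (List (Subset n)) λ ts → cs ≡ List.map (false ∷_) ts
  ∌zero⇒map-false∷ []                 []          = [] , refl
  ∌zero⇒map-false∷ ((true ∷ t) ∷ cs)  (0∉ ∷ _)    = ⊥-elim (0∉ here)
  ∌zero⇒map-false∷ ((false ∷ t) ∷ cs) (_ ∷ 0∉cs) with ∌zero⇒map-false∷ cs 0∉cs
  ... | ts , refl = t ∷ ts , refl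

  ListΠ⇒withFirstBlock : ∀ {d} bs → ListΠ d (suc n) bs →
                         Σ (Subset n) λ s → Σ (List (Subset n)) λ ts → bs ≡ withFirstBlock s ts
  ListΠ⇒withFirstBlock [] (mkPartition _ _ covers _ _ , _) with covers {zero} ∈⊤
  ... | ()
  ListΠ⇒withFirstBlock (b ∷ cs) (π@(mkPartition _ _ _ (b∩cs=∅ ∷ _) _) , _)
    with b | zero∈firstBlock π | ∌zero⇒map-false∷ cs (All.map (λ b∩c=∅ → b∩c=∅ (zero∈firstBlock π)) b∩cs=∅)
  ... | true ∷ s | here | ts , refl = s , ts , refl

  ListΠ-withFirstBlock⁻ : ∀ {d} (s : Subset n) ts → ListΠ d (suc n) (withFirstBlock s ts) → StrictΠ d (∁ s) ts
  ListΠ-withFirstBlock⁻ s ts (mkPartition (_ ∷ nonempty) _ covers (s∩ts=∅ ∷ disjoint) (_ ∷ ordered) , linked) =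
    mkPartition (All.map Nonempty-false∷⁻ (All.map⁻ nonempty))
                (All.map (λ s∩t=∅ {x} x∈t → x∉p⇒x∈∁p λ x∈s → s∩t=∅ (there x∈s) (there x∈t)) (All.map⁻ s∩ts=∅))
                (λ x∈∁s → coveredByTs x∈∁s (covers ∈⊤))
                (AllPairs.map Disjoint-false∷⁻ (AllPairs.map⁻ disjoint))
                (AllPairs.map MinBefore-false∷⁻ (AllPairs.map⁻ ordered)) ,
    Linked.map (λ {a} {b} → AboveMax-false∷⁻ {a = a} {b}) (Linked.map⁻ linked)
    where
    coveredByTs : ∀ {x} → x ∈ ∁ s → Any (suc x ∈_) (withFirstBlock s ts) → Any (x ∈_) ts
    coveredByTs x∈∁s (here (there x∈s)) = ⊥-elim (x∈∁p⇒x∉p x∈∁s x∈s)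
    coveredByTs x∈∁s (there x∈ts)       = Any.map (λ { (there x∈t) → x∈t }) (Any.map⁻ x∈ts)

  ListΠ-withFirstBlock⁺ : ∀ {d} (s : Subset n) ts → StrictΠ d (∁ s) ts → ListΠ d (suc n) (withFirstBlock s ts)
  ListΠ-withFirstBlock⁺ s ts (mkPartition nonempty ⊆∁s covers disjoint ordered , linked) =
    mkPartition ((zero , here) ∷ All.map⁺ (All.map (λ (i , i∈) → suc i , there i∈) nonempty))
                (All.universal (λ _ {x} _ → ∈⊤) _)
                covered
                (All.map⁺ (All.map s∩t=∅ ⊆∁s) ∷ AllPairs.map⁺ (AllPairs.map Disjoint-false∷⁺ disjoint))
                (All.map⁺ (All.universal (λ _ → firstMinBefore) ts) ∷ AllPairs.map⁺ (AllPairs.map MinBefore-false∷⁺ ordered)) ,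
    Linked.map⁺ (Linked.map (λ {a} {b} → AboveMax-false∷⁺ {a = a} {b}) linked)
    where
    covered : ∀ {x} → x ∈ ⊤ → Any (x ∈_) (withFirstBlock s ts)
    covered {zero}  _ = here here
    covered {suc x} _ with x ∈? s
    ... | yes x∈s = here (there x∈s)
    ... | no  x∉s = there (Any.map⁺ (Any.map there (covers (x∉p⇒x∈∁p x∉s))))
    s∩t=∅ : ∀ {t} → t ⊆ ∁ s → Disjoint (true ∷ s) (false ∷ t)
    s∩t=∅ t⊆∁s (there x∈s) (there x∈t) = x∈∁p⇒x∉p (t⊆∁s x∈t) x∈s
    firstMinBefore : ∀ {t} → MinBefore (true ∷ s) (false ∷ t)
    firstMinBefore ma (suc mb) (_ , ma≤) _ = s≤s (≤-trans (ma≤ zero here) z≤n)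
    firstMinBefore ma zero     _         (() , _)

-- Compressing the complement of a subset

above-zero : ∀ {n} → above (zero {n}) ≡ false ∷ ⊤
above-zero {n} = cong (false ∷_) (trans (tabulate-allFin (const true)) (map-const (allFin n) true))

∣∩above-zero∣ : ∀ {n} (x : Bool) (t : Subset n) → ∣ (x ∷ t) ∩ above zero ∣ ≡ ∣ t ∣
∣∩above-zero∣ x t = begin
  ∣ (x ∷ t) ∩ above zero ∣  ≡⟨ cong (λ z → ∣ (x ∷ t) ∩ z ∣) above-zero ⟩
  ∣ (x ∧ false) ∷ t ∩ ⊤ ∣   ≡⟨ cong (λ y → ∣ y ∷ t ∩ ⊤ ∣) (∧-zeroʳ x) ⟩
  ∣ t ∩ ⊤ ∣                 ≡⟨ cong ∣_∣ (∩-identityʳ t) ⟩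
  ∣ t ∣                     ∎
  where open ≡-Reasoning

∣above∣ : ∀ {n} (M : Fin n) → ∣ above M ∣ ≡ n ∸ suc (toℕ M)
∣above∣ {suc n} zero    = trans (cong ∣_∣ (above-zero {n})) (∣⊤∣≡n n)
∣above∣         (suc M) = ∣above∣ M

-- compress s and expand s move subsets of ∁ s to and from [∣ ∁ s ∣] along the
-- increasing bijection embed s : [∣ ∁ s ∣] → ∁ s.
compress : ∀ {n} (s : Subset n) → Subset n → Subset ∣ ∁ s ∣
compress []          []      = []
compress (true ∷ s)  (_ ∷ t) = compress s t
compress (false ∷ s) (x ∷ t) = x ∷ compress s t

expand : ∀ {n} (s : Subset n) → Subset ∣ ∁ s ∣ → Subset n
expand []          []      = []
expand (true ∷ s)  a       = false ∷ expand s a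
expand (false ∷ s) (x ∷ a) = x ∷ expand s a

embed : ∀ {n} (s : Subset n) → Fin ∣ ∁ s ∣ → Fin n
embed (true ∷ s)  i       = suc (embed s i)
embed (false ∷ s) zero    = zero
embed (false ∷ s) (suc i) = suc (embed s i)

⊆∁-head : ∀ {n} {s t : Subset n} {x} → (x ∷ t) ⊆ ∁ (true ∷ s) → x ≡ false
⊆∁-head {x = false} _   = refl
⊆∁-head {x = true}  t⊆ with t⊆ here
... | ()

⊆∁-tail : ∀ {n} {s t : Subset n} {b x} → (x ∷ t) ⊆ ∁ (b ∷ s) → t ⊆ ∁ s
⊆∁-tail t⊆ x∈t with t⊆ (there x∈t)
... | there x∈∁s = x∈∁s

compress-expand : ∀ {n} (s : Subset n) a → compress s (expand s a) ≡ a
compress-expand []          []      = refl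
compress-expand (true ∷ s)  a       = compress-expand s a
compress-expand (false ∷ s) (x ∷ a) = cong (x ∷_) (compress-expand s a)

expand-compress : ∀ {n} (s : Subset n) t → t ⊆ ∁ s → expand s (compress s t) ≡ t
expand-compress []          []      _  = refl
expand-compress (true ∷ s)  (x ∷ t) t⊆ with ⊆∁-head t⊆
... | refl = cong (false ∷_) (expand-compress s t (⊆∁-tail t⊆))
expand-compress (false ∷ s) (x ∷ t) t⊆ = cong (x ∷_) (expand-compress s t (⊆∁-tail t⊆))

expand⊆∁ : ∀ {n} (s : Subset n) a → expand s a ⊆ ∁ s
expand⊆∁ (true ∷ s)  a       (there x∈) = there (expand⊆∁ s a x∈)
expand⊆∁ (false ∷ s) (_ ∷ a) here       = here
expand⊆∁ (false ∷ s) (_ ∷ a) (there x∈) = there (expand⊆∁ s a x∈)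

embed∈∁ : ∀ {n} (s : Subset n) i → embed s i ∈ ∁ s
embed∈∁ (true ∷ s)  i       = there (embed∈∁ s i)
embed∈∁ (false ∷ s) zero    = here
embed∈∁ (false ∷ s) (suc i) = there (embed∈∁ s i)

∈∁⇒embed : ∀ {n} (s : Subset n) {x} → x ∈ ∁ s → Σ (Fin ∣ ∁ s ∣) λ i → embed s i ≡ x
∈∁⇒embed (true ∷ s)  (there x∈) with ∈∁⇒embed s x∈
... | i , refl = i , refl
∈∁⇒embed (false ∷ s) here       = zero , refl
∈∁⇒embed (false ∷ s) (there x∈) with ∈∁⇒embed s x∈
... | i , refl = suc i , refl

∈-compress⁺ : ∀ {n} (s : Subset n) t {i} → embed s i ∈ t → i ∈ compress s t
∈-compress⁺ (true ∷ s)  (_ ∷ t)         (there i∈) = ∈-compress⁺ s t i∈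
∈-compress⁺ (false ∷ s) (_ ∷ t) {zero}  here       = here
∈-compress⁺ (false ∷ s) (_ ∷ t) {suc i} (there i∈) = there (∈-compress⁺ s t i∈)

∈-compress⁻ : ∀ {n} (s : Subset n) t {i} → i ∈ compress s t → embed s i ∈ t
∈-compress⁻ (true ∷ s)  (_ ∷ t)         i∈         = there (∈-compress⁻ s t i∈)
∈-compress⁻ (false ∷ s) (_ ∷ t) {zero}  here       = here
∈-compress⁻ (false ∷ s) (_ ∷ t) {suc i} (there i∈) = there (∈-compress⁻ s t i∈)

embed-mono-≤ : ∀ {n} (s : Subset n) i j → toℕ i ≤ toℕ j → toℕ (embed s i) ≤ toℕ (embed s j)
embed-mono-≤ (true ∷ s)  i       j       i≤j       = s≤s (embed-mono-≤ s i j i≤j)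
embed-mono-≤ (false ∷ s) zero    j       _         = z≤n
embed-mono-≤ (false ∷ s) (suc i) (suc j) (s≤s i≤j) = s≤s (embed-mono-≤ s i j i≤j)

embed-mono-< : ∀ {n} (s : Subset n) i j → toℕ i < toℕ j → toℕ (embed s i) < toℕ (embed s j)
embed-mono-< (true ∷ s)  i       j       i<j       = s≤s (embed-mono-< s i j i<j)
embed-mono-< (false ∷ s) zero    (suc j) _         = s≤s z≤n
embed-mono-< (false ∷ s) (suc i) (suc j) (s≤s i<j) = s≤s (embed-mono-< s i j i<j)

embed-cancel-≤ : ∀ {n} (s : Subset n) i j → toℕ (embed s i) ≤ toℕ (embed s j) → toℕ i ≤ toℕ j
embed-cancel-≤ s i j = ≮⇒≥ ∘ contraposition (embed-mono-< s j i) ∘ ≤⇒≯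

embed-cancel-< : ∀ {n} (s : Subset n) i j → toℕ (embed s i) < toℕ (embed s j) → toℕ i < toℕ j
embed-cancel-< s i j = ≰⇒> ∘ contraposition (embed-mono-≤ s j i) ∘ <⇒≱

∣compress∣ : ∀ {n} (s : Subset n) t → t ⊆ ∁ s → ∣ compress s t ∣ ≡ ∣ t ∣
∣compress∣ []          []          _  = refl
∣compress∣ (true ∷ s)  (x ∷ t)     t⊆ with ⊆∁-head t⊆
... | refl = ∣compress∣ s t (⊆∁-tail t⊆)
∣compress∣ (false ∷ s) (true ∷ t)  t⊆ = cong suc (∣compress∣ s t (⊆∁-tail t⊆))
∣compress∣ (false ∷ s) (false ∷ t) t⊆ = ∣compress∣ s t (⊆∁-tail t⊆)

∣compress∩above∣ : ∀ {n} (s : Subset n) t M → t ⊆ ∁ s → ∣ compress s t ∩ above M ∣ ≡ ∣ t ∩ above (embed s M) ∣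
∣compress∩above∣ (true ∷ s)  (x ∷ t)     M       t⊆ with ⊆∁-head t⊆
... | refl = ∣compress∩above∣ s t M (⊆∁-tail t⊆)
∣compress∩above∣ (false ∷ s) (x ∷ t)     zero    t⊆ =
  trans (∣∩above-zero∣ x (compress s t)) (trans (∣compress∣ s t (⊆∁-tail t⊆)) (sym (∣∩above-zero∣ x t)))
∣compress∩above∣ (false ∷ s) (true ∷ t)  (suc M) t⊆ = ∣compress∩above∣ s t M (⊆∁-tail t⊆)
∣compress∩above∣ (false ∷ s) (false ∷ t) (suc M) t⊆ = ∣compress∩above∣ s t M (⊆∁-tail t⊆)

module _ {n : ℕ} (s : Subset n) where

  IsMin-compress⁺ : ∀ {t m} → IsMin t (embed s m) → IsMin (compress s t) m
  IsMin-compress⁺ {t} {m} (m∈ , m≤) = ∈-compress⁺ s t m∈ , λ j j∈ → embed-cancel-≤ s m j (m≤ _ (∈-compress⁻ s t j∈))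

  IsMin-compress⁻ : ∀ {t m} → t ⊆ ∁ s → IsMin (compress s t) m → IsMin t (embed s m)
  IsMin-compress⁻ {t} {m} t⊆ (m∈ , m≤) = ∈-compress⁻ s t m∈ , λ y y∈ → embedded y∈ (∈∁⇒embed s (t⊆ y∈))
    where
    embedded : ∀ {y} → y ∈ t → Σ _ (λ j → embed s j ≡ y) → toℕ (embed s m) ≤ toℕ y
    embedded y∈ (j , refl) = embed-mono-≤ s m j (m≤ j (∈-compress⁺ s t y∈))

  IsMax-compress⁺ : ∀ {t m} → IsMax t (embed s m) → IsMax (compress s t) m
  IsMax-compress⁺ {t} {m} (m∈ , ≤m) = ∈-compress⁺ s t m∈ , λ j j∈ → embed-cancel-≤ s j m (≤m _ (∈-compress⁻ s t j∈))

  IsMax-compress⁻ : ∀ {t m} → t ⊆ ∁ s → IsMax (compress s t) m → IsMax t (embed s m)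
  IsMax-compress⁻ {t} {m} t⊆ (m∈ , ≤m) = ∈-compress⁻ s t m∈ , λ y y∈ → embedded y∈ (∈∁⇒embed s (t⊆ y∈))
    where
    embedded : ∀ {y} → y ∈ t → Σ _ (λ j → embed s j ≡ y) → toℕ y ≤ toℕ (embed s m)
    embedded y∈ (j , refl) = embed-mono-≤ s j m (≤m j (∈-compress⁺ s t y∈))

  Nonempty-compress⁺ : ∀ {t} → t ⊆ ∁ s → Nonempty t → Nonempty (compress s t)
  Nonempty-compress⁺ {t} t⊆ (x , x∈) with ∈∁⇒embed s (t⊆ x∈)
  ... | i , refl = i , ∈-compress⁺ s t x∈

  Nonempty-compress⁻ : ∀ {t} → Nonempty (compress s t) → Nonempty t
  Nonempty-compress⁻ {t} (i , i∈) = embed s i , ∈-compress⁻ s t i∈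

  module _ {a b : Subset n} (a⊆ : a ⊆ ∁ s) (b⊆ : b ⊆ ∁ s) where

    Disjoint-compress⁺ : Disjoint a b → Disjoint (compress s a) (compress s b)
    Disjoint-compress⁺ a∩b=∅ i∈a i∈b = a∩b=∅ (∈-compress⁻ s a i∈a) (∈-compress⁻ s b i∈b)

    Disjoint-compress⁻ : Disjoint (compress s a) (compress s b) → Disjoint a b
    Disjoint-compress⁻ a∩b=∅ x∈a x∈b with ∈∁⇒embed s (a⊆ x∈a)
    ... | i , refl = a∩b=∅ (∈-compress⁺ s a x∈a) (∈-compress⁺ s b x∈b)

    MinBefore-compress⁺ : MinBefore a b → MinBefore (compress s a) (compress s b)
    MinBefore-compress⁺ a<b i j i-min j-min =
      embed-cancel-< s i j (a<b _ _ (IsMin-compress⁻ a⊆ i-min) (IsMin-compress⁻ b⊆ j-min))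

    MinBefore-compress⁻ : MinBefore (compress s a) (compress s b) → MinBefore a b
    MinBefore-compress⁻ a<b x y x-min y-min with ∈∁⇒embed s (a⊆ (proj₁ x-min)) | ∈∁⇒embed s (b⊆ (proj₁ y-min))
    ... | i , refl | j , refl = embed-mono-< s i j (a<b i j (IsMin-compress⁺ x-min) (IsMin-compress⁺ y-min))

    AboveMax-compress⁺ : ∀ {d} → AboveMax d a b → AboveMax d (compress s a) (compress s b)
    AboveMax-compress⁺ a>b j j-max =
      subst (_ ≤_) (sym (∣compress∩above∣ s a j a⊆)) (a>b (embed s j) (IsMax-compress⁻ b⊆ j-max))

    AboveMax-compress⁻ : ∀ {d} → AboveMax d (compress s a) (compress s b) → AboveMax d a b
    AboveMax-compress⁻ a>b M M-max with ∈∁⇒embed s (b⊆ (proj₁ M-max))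
    ... | j , refl = subst (_ ≤_) (∣compress∩above∣ s a j a⊆) (a>b j (IsMax-compress⁺ M-max))

module _ {n : ℕ} (s : Subset n) where

  map-compress-expand : ∀ as → List.map (compress s) (List.map (expand s) as) ≡ as
  map-compress-expand as = trans (sym (map-∘ as)) (map-id-local (All.universal (compress-expand s) as))

  map-expand-compress : ∀ {ts} → All (_⊆ ∁ s) ts → List.map (expand s) (List.map (compress s) ts) ≡ ts
  map-expand-compress {ts} ⊆∁s = trans (sym (map-∘ ts)) (map-id-local (All.map (expand-compress s _) ⊆∁s))

module _ {n : ℕ} (s : Subset n) {d : ℕ} where

  StrictΠ-compress⁺ : ∀ {ts} → StrictΠ d (∁ s) ts → StrictΠ d ⊤ (List.map (compress s) ts)
  StrictΠ-compress⁺ (mkPartition nonempty ⊆∁s covers disjoint ordered , linked) =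
    mkPartition (All.map⁺ (All.zipWith {P = _⊆ ∁ s} (λ (t⊆ , ne) → Nonempty-compress⁺ s t⊆ ne) (⊆∁s , nonempty)))
                (All.universal (λ _ {x} _ → ∈⊤) _)
                (λ {i} _ → Any.map⁺ (Any.map (∈-compress⁺ s _) (covers (embed∈∁ s i))))
                (AllPairs.map⁺ (AllPairs-mapWith ⊆∁s (Disjoint-compress⁺ s) disjoint))
                (AllPairs.map⁺ (AllPairs-mapWith ⊆∁s (MinBefore-compress⁺ s) ordered)) ,
    Linked.map⁺ (Linked-mapWith ⊆∁s (λ a⊆ b⊆ → AboveMax-compress⁺ s a⊆ b⊆) linked)

  StrictΠ-compress⁻ : ∀ {ts} → All (_⊆ ∁ s) ts → StrictΠ d ⊤ (List.map (compress s) ts) → StrictΠ d (∁ s) ts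
  StrictΠ-compress⁻ {ts} ⊆∁s (mkPartition nonempty _ covers disjoint ordered , linked) =
    mkPartition (All.map (Nonempty-compress⁻ s) (All.map⁻ nonempty))
                ⊆∁s
                covered
                (AllPairs-mapWith ⊆∁s (Disjoint-compress⁻ s) (AllPairs.map⁻ disjoint))
                (AllPairs-mapWith ⊆∁s (MinBefore-compress⁻ s) (AllPairs.map⁻ ordered)) ,
    Linked-mapWith ⊆∁s (λ a⊆ b⊆ → AboveMax-compress⁻ s a⊆ b⊆) (Linked.map⁻ linked)
    where
    covered : ∀ {x} → x ∈ ∁ s → Any (x ∈_) ts
    covered x∈ with ∈∁⇒embed s x∈
    ... | i , refl = Any.map (∈-compress⁻ s _) (Any.map⁻ (covers ∈⊤))

  StrictΠ-expand : ∀ {as} → StrictΠ d ⊤ as → StrictΠ d (∁ s) (List.map (expand s) as)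
  StrictΠ-expand {as} π = StrictΠ-compress⁻ (All.map⁺ (All.universal (expand⊆∁ s) as))
                                            (subst (StrictΠ d ⊤) (sym (map-compress-expand s as)) π)

-- Partitions satisfying the condition for every pair of blocks

AboveMax⇒below : ∀ {k d} {a b : Subset k} {x} → AboveMax d a b → x ∈ b → d + suc (toℕ x) ≤ k
AboveMax⇒below {k} {d} {a} {b} {x} a>b x∈b with maximum b (x , x∈b)
... | M , M-max@(_ , ≤M) = begin
  d + suc (toℕ x)              ≤⟨ +-monoʳ-≤ d (s≤s (≤M x x∈b)) ⟩
  d + suc (toℕ M)              ≤⟨ +-monoˡ-≤ (suc (toℕ M)) d≤rest ⟩
  k ∸ suc (toℕ M) + suc (toℕ M) ≡⟨ m∸n+n≡m (toℕ<n M) ⟩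
  k                            ∎
  where
  open ≤-Reasoning
  d≤rest : d ≤ k ∸ suc (toℕ M)
  d≤rest = ≤-trans (a>b M M-max) (≤-trans (∣p∩q∣≤∣q∣ a (above M)) (≤-reflexive (∣above∣ M)))

trivialPartition : (k : ℕ) → List (Subset k)
trivialPartition zero    = []
trivialPartition (suc k) = ⊤ ∷ []

StrictΠ-trivialPartition : ∀ d k → StrictΠ d ⊤ (trivialPartition k)
StrictΠ-trivialPartition d zero    = mkPartition [] [] (λ { {()} }) [] [] , []
StrictΠ-trivialPartition d (suc k) = mkPartition ((zero , ∈⊤) ∷ []) (⊆⊤ ∷ []) (λ _ → here ∈⊤) ([] ∷ []) ([] ∷ []) , [-]

-- With at most d + 1 elements, a second block would have to lie below the top d elements
-- while not containing the least element.
StrictΠ-small : ∀ d k bs → k ≤ suc d → StrictΠ d ⊤ bs → bs ≡ trivialPartition k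
StrictΠ-small d zero    []           _ _ = refl
StrictΠ-small d (suc k) []           _ (mkPartition _ _ covers _ _ , _) with covers {zero} ∈⊤
... | ()
StrictΠ-small d zero    (b ∷ [])     _ (mkPartition ((() , _) ∷ _) _ _ _ _ , _)
StrictΠ-small d (suc k) (b ∷ [])     _ (mkPartition _ _ covers _ _ , _) =
  cong (_∷ []) (⊆-antisym ⊆⊤ λ _ → inSingleBlock (covers ∈⊤))
  where
  inSingleBlock : ∀ {x} → Any (x ∈_) (b ∷ []) → x ∈ b
  inSingleBlock (here x∈b) = x∈b
StrictΠ-small d k (a ∷ b ∷ _) k≤1+d (mkPartition (ne-a ∷ ne-b ∷ _) _ _ _ ((a<b ∷ _) ∷ _) , a>b ∷ _)
  with minimum a ne-a | minimum b ne-b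
... | ma , ma-min | mb , mb-min@(mb∈b , _) = ⊥-elim (<-irrefl refl (begin
  suc (suc d)       ≡⟨ +-comm 2 d ⟩
  d + 2             ≤⟨ +-monoʳ-≤ d (s≤s (≤-trans (s≤s z≤n) (a<b ma mb ma-min mb-min))) ⟩
  d + suc (toℕ mb)  ≤⟨ AboveMax⇒below {a = a} a>b mb∈b ⟩
  k                 ≤⟨ k≤1+d ⟩
  suc d             ∎))
  where open ≤-Reasoning

split↑ : ∀ m {d} (x : Fin (m + d)) → (Σ (Fin m) λ i → x ≡ i ↑ˡ d) ⊎ (Σ (Fin d) λ j → x ≡ m ↑ʳ j)
split↑ m x with splitAt m x in eq
... | inj₁ i = inj₁ (i , sym (splitAt⁻¹-↑ˡ eq))
... | inj₂ j = inj₂ (j , sym (splitAt⁻¹-↑ʳ eq))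

module _ {d : ℕ} where

  ∈-↑ˡ-++⁺ : ∀ {m} (a : Subset m) {u : Subset d} {i} → i ∈ a → i ↑ˡ d ∈ a ++ u
  ∈-↑ˡ-++⁺ (_ ∷ a) here       = here
  ∈-↑ˡ-++⁺ (_ ∷ a) (there i∈) = there (∈-↑ˡ-++⁺ a i∈)

  ∈-↑ˡ-++⁻ : ∀ {m} (a : Subset m) {u : Subset d} {i} → i ↑ˡ d ∈ a ++ u → i ∈ a
  ∈-↑ˡ-++⁻ (_ ∷ a) {i = zero}  here       = here
  ∈-↑ˡ-++⁻ (_ ∷ a) {i = suc i} (there i∈) = there (∈-↑ˡ-++⁻ a i∈)

  ∈-↑ʳ-++⁺ : ∀ {m} (a : Subset m) {u : Subset d} {j} → j ∈ u → m ↑ʳ j ∈ a ++ u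
  ∈-↑ʳ-++⁺ []      j∈ = j∈
  ∈-↑ʳ-++⁺ (_ ∷ a) j∈ = there (∈-↑ʳ-++⁺ a j∈)

  ∈-↑ʳ-++⁻ : ∀ {m} (a : Subset m) {u : Subset d} {j} → m ↑ʳ j ∈ a ++ u → j ∈ u
  ∈-↑ʳ-++⁻ []      j∈         = j∈
  ∈-↑ʳ-++⁻ (_ ∷ a) (there j∈) = ∈-↑ʳ-++⁻ a j∈

  ∣++∣ : ∀ {m} (a : Subset m) (u : Subset d) → ∣ a ++ u ∣ ≡ ∣ a ∣ + ∣ u ∣
  ∣++∣ []          u = refl
  ∣++∣ (true ∷ a)  u = cong suc (∣++∣ a u)
  ∣++∣ (false ∷ a) u = ∣++∣ a u

  ⊤-++ : ∀ m → ⊤ {m + d} ≡ ⊤ {m} ++ ⊤ {d}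
  ⊤-++ zero    = refl
  ⊤-++ (suc m) = cong (true ∷_) (⊤-++ m)

  above-↑ˡ : ∀ {m} (j : Fin m) → above (j ↑ˡ d) ≡ above j ++ ⊤ {d}
  above-↑ˡ {suc m} zero    = trans (above-zero {m + d}) (trans (cong (false ∷_) (⊤-++ m)) (cong (_++ ⊤) (sym (above-zero {m}))))
  above-↑ˡ         (suc j) = cong (false ∷_) (above-↑ˡ j)

  ∣++∩above-↑ˡ∣ : ∀ {m} (a : Subset m) (u : Subset d) j → ∣ (a ++ u) ∩ above (j ↑ˡ d) ∣ ≡ ∣ a ∩ above j ∣ + ∣ u ∣
  ∣++∩above-↑ˡ∣ a u j = begin
    ∣ (a ++ u) ∩ above (j ↑ˡ d) ∣      ≡⟨ cong (λ z → ∣ (a ++ u) ∩ z ∣) (above-↑ˡ j) ⟩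
    ∣ (a ++ u) ∩ (above j ++ ⊤) ∣      ≡⟨ cong ∣_∣ (zipWith-++ _∧_ a u (above j) ⊤) ⟩
    ∣ (a ∩ above j) ++ (u ∩ ⊤) ∣       ≡⟨ ∣++∣ (a ∩ above j) (u ∩ ⊤) ⟩
    ∣ a ∩ above j ∣ + ∣ u ∩ ⊤ ∣        ≡⟨ cong (∣ a ∩ above j ∣ +_) (cong ∣_∣ (∩-identityʳ u)) ⟩
    ∣ a ∩ above j ∣ + ∣ u ∣            ∎
    where open ≡-Reasoning

module _ {m d : ℕ} where

  Nonempty-++⁺ : ∀ {a : Subset m} {u : Subset d} → Nonempty a → Nonempty (a ++ u)
  Nonempty-++⁺ {a} (i , i∈) = i ↑ˡ d , ∈-↑ˡ-++⁺ a i∈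

  Nonempty-++⊥⁻ : ∀ {a : Subset m} → Nonempty (a ++ ⊥ {d}) → Nonempty a
  Nonempty-++⊥⁻ {a} (x , x∈) with split↑ m x
  ... | inj₁ (i , refl) = i , ∈-↑ˡ-++⁻ a x∈
  ... | inj₂ (j , refl) = ⊥-elim (∉⊥ (∈-↑ʳ-++⁻ a x∈))

  Disjoint-++⊥⁺ : ∀ {a b : Subset m} {u : Subset d} → Disjoint a b → Disjoint (a ++ u) (b ++ ⊥)
  Disjoint-++⊥⁺ {a} {b} a∩b=∅ {x} x∈a x∈b with split↑ m x
  ... | inj₁ (i , refl) = a∩b=∅ (∈-↑ˡ-++⁻ a x∈a) (∈-↑ˡ-++⁻ b x∈b)
  ... | inj₂ (j , refl) = ∉⊥ (∈-↑ʳ-++⁻ b x∈b)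

  Disjoint-++⁻ : ∀ {a b : Subset m} {u w : Subset d} → Disjoint (a ++ u) (b ++ w) → Disjoint a b
  Disjoint-++⁻ {a} {b} a∩b=∅ i∈a i∈b = a∩b=∅ (∈-↑ˡ-++⁺ a i∈a) (∈-↑ˡ-++⁺ b i∈b)

  IsMin-++ : ∀ {a : Subset m} {u : Subset d} {i} → IsMin a i → IsMin (a ++ u) (i ↑ˡ d)
  IsMin-++ {a} {u} {i} (i∈ , i≤) = ∈-↑ˡ-++⁺ a i∈ , λ y y∈ → i≤y y y∈ (split↑ m y)
    where
    i≤y : ∀ y → y ∈ a ++ u → (Σ _ λ i′ → y ≡ i′ ↑ˡ d) ⊎ (Σ _ λ j → y ≡ m ↑ʳ j) → toℕ (i ↑ˡ d) ≤ toℕ y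
    i≤y _ y∈ (inj₁ (i′ , refl)) = subst₂ _≤_ (sym (toℕ-↑ˡ i d)) (sym (toℕ-↑ˡ i′ d)) (i≤ i′ (∈-↑ˡ-++⁻ a y∈))
    i≤y _ _  (inj₂ (j , refl))  =
      subst₂ _≤_ (sym (toℕ-↑ˡ i d)) (sym (toℕ-↑ʳ m j)) (≤-trans (<⇒≤ (toℕ<n i)) (m≤m+n m (toℕ j)))

  IsMax-++⊥ : ∀ {a : Subset m} {j} → IsMax a j → IsMax (a ++ ⊥ {d}) (j ↑ˡ d)
  IsMax-++⊥ {a} {j} (j∈ , ≤j) = ∈-↑ˡ-++⁺ a j∈ , λ y y∈ → y≤j y y∈ (split↑ m y)
    where
    y≤j : ∀ y → y ∈ a ++ ⊥ → (Σ _ λ i → y ≡ i ↑ˡ d) ⊎ (Σ _ λ j′ → y ≡ m ↑ʳ j′) → toℕ y ≤ toℕ (j ↑ˡ d)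
    y≤j _ y∈ (inj₁ (i , refl)) = subst₂ _≤_ (sym (toℕ-↑ˡ i d)) (sym (toℕ-↑ˡ j d)) (≤j i (∈-↑ˡ-++⁻ a y∈))
    y≤j _ y∈ (inj₂ (j′ , refl)) = ⊥-elim (∉⊥ (∈-↑ʳ-++⁻ a y∈))

  MinBefore-++⁺ : ∀ {a b : Subset m} {u w : Subset d} → Nonempty a → Nonempty b → MinBefore a b → MinBefore (a ++ u) (b ++ w)
  MinBefore-++⁺ {a} {b} ne-a ne-b a<b x y x-min y-min with minimum a ne-a | minimum b ne-b
  ... | i , i-min | j , j-min with IsMin-unique x-min (IsMin-++ i-min) | IsMin-unique y-min (IsMin-++ j-min)
  ... | refl | refl = subst₂ _<_ (sym (toℕ-↑ˡ i d)) (sym (toℕ-↑ˡ j d)) (a<b i j i-min j-min)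

  MinBefore-++⁻ : ∀ {a b : Subset m} {u w : Subset d} → MinBefore (a ++ u) (b ++ w) → MinBefore a b
  MinBefore-++⁻ a<b i j i-min j-min = subst₂ _<_ (toℕ-↑ˡ i d) (toℕ-↑ˡ j d) (a<b _ _ (IsMin-++ i-min) (IsMin-++ j-min))

  AboveMax-++⁺ : ∀ {e} {a b : Subset m} {u : Subset d} → Nonempty b → AboveMax e a b → AboveMax e (a ++ u) (b ++ ⊥)
  AboveMax-++⁺ {a = a} {b} {u} ne-b a>b M M-max with maximum b ne-b
  ... | j , j-max with IsMax-unique M-max (IsMax-++⊥ j-max)
  ... | refl = subst (_ ≤_) (sym (∣++∩above-↑ˡ∣ a u j)) (≤-trans (a>b j j-max) (m≤m+n _ _))

  AboveMax-++⊥⁻ : ∀ {e} {a b : Subset m} → AboveMax e (a ++ ⊥ {d}) (b ++ ⊥) → AboveMax e a b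
  AboveMax-++⊥⁻ {a = a} a>b j j-max =
    subst (_ ≤_) (trans (∣++∩above-↑ˡ∣ a ⊥ j) (trans (cong (_ +_) (∣⊥∣≡0 d)) (+-identityʳ _))) (a>b _ (IsMax-++⊥ j-max))

  AboveMax-++⊤ : ∀ {a b : Subset m} → Nonempty b → AboveMax d (a ++ ⊤) (b ++ ⊥)
  AboveMax-++⊤ {a} {b} ne-b M M-max with maximum b ne-b
  ... | j , j-max with IsMax-unique M-max (IsMax-++⊥ j-max)
  ... | refl = subst (_ ≤_) (sym (∣++∩above-↑ˡ∣ a ⊤ j)) (≤-trans (≤-reflexive (sym (∣⊤∣≡n d))) (m≤n+m _ _))

module _ {m d : ℕ} where

  joinTop : List (Subset m) → List (Subset (m + d))
  joinTop []       = []
  joinTop (b ∷ bs) = (b ++ ⊤) ∷ List.map (_++ ⊥) bs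

  dropTop : List (Subset (m + d)) → List (Subset m)
  dropTop = List.map (take m)

  take-++ : ∀ (a : Subset m) (u : Subset d) → take m (a ++ u) ≡ a
  take-++ a u = sym (++-injectiveˡ a (take m (a ++ u)) (proj₂ (proj₂ (Vec.splitAt m (a ++ u)))))

  dropTop-joinTop : ∀ bs → dropTop (joinTop bs) ≡ bs
  dropTop-joinTop []       = refl
  dropTop-joinTop (b ∷ bs) =
    cong₂ _∷_ (take-++ b ⊤) (trans (sym (map-∘ bs)) (map-id-local (All.universal (λ c → take-++ c ⊥) bs)))

  ∈-drop⁺ : ∀ (v : Subset (m + d)) {j} → m ↑ʳ j ∈ v → j ∈ drop m v
  ∈-drop⁺ v j∈ = ∈-↑ʳ-++⁻ (take m v) (subst (_ ∈_) (sym (take++drop≡id m v)) j∈)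

  ∈-drop⁻ : ∀ (v : Subset (m + d)) {j} → j ∈ drop m v → m ↑ʳ j ∈ v
  ∈-drop⁻ v j∈ = subst (_ ∈_) (take++drop≡id m v) (∈-↑ʳ-++⁺ (take m v) j∈)

  take-++⊤ : ∀ (v : Subset (m + d)) → (∀ j → m ↑ʳ j ∈ v) → take m v ++ ⊤ ≡ v
  take-++⊤ v top⊆v = trans (cong (take m v ++_) (⊆-antisym (λ {j} _ → ∈-drop⁺ v (top⊆v j)) ⊆⊤)) (take++drop≡id m v)

  take-++⊥ : ∀ (v : Subset (m + d)) → (∀ j → m ↑ʳ j ∉ v) → take m v ++ ⊥ ≡ v
  take-++⊥ v top∩v=∅ =
    trans (cong (take m v ++_) (sym (Empty-unique λ (j , j∈) → top∩v=∅ j (∈-drop⁻ v j∈)))) (take++drop≡id m v)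

module _ {m d : ℕ} where

  ListΠ⇒StrictΠ-joinTop : ∀ {bs} → ListΠ d (suc m) bs → StrictΠ d ⊤ (joinTop {d = d} bs)
  ListΠ⇒StrictΠ-joinTop {[]} (mkPartition _ _ covers _ _ , _) with covers {zero} ∈⊤
  ... | ()
  ListΠ⇒StrictΠ-joinTop {b ∷ bs} (mkPartition (ne-b ∷ ne-bs) _ covers (b∩bs=∅ ∷ disjoint) (b<bs ∷ ordered) , linked) =
    mkPartition (Nonempty-++⁺ ne-b ∷ All.map⁺ (All.map Nonempty-++⁺ ne-bs))
                (All.universal (λ _ {x} → ⊆⊤ {x = x}) _)
                covered
                (All.map⁺ (All.map Disjoint-++⊥⁺ b∩bs=∅) ∷
                   AllPairs.map⁺ (AllPairs.map Disjoint-++⊥⁺ disjoint))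
                (All.map⁺ (All.zipWith {P = Nonempty} (λ (ne-c , b<c) → MinBefore-++⁺ ne-b ne-c b<c) (ne-bs , b<bs)) ∷
                   AllPairs.map⁺ (AllPairs-mapWith ne-bs MinBefore-++⁺ ordered)) ,
    linkedJoin bs ne-bs linked
    where
    linkedJoin : ∀ cs → All Nonempty cs → Linked (AboveMax d) cs → Linked (AboveMax d) ((b ++ ⊤) ∷ List.map (_++ ⊥) cs)
    linkedJoin []       _              _      = [-]
    linkedJoin (c ∷ cs) ne-ccs@(ne-c ∷ _) linked =
      AboveMax-++⊤ {a = b} ne-c ∷ Linked.map⁺ (Linked-mapWith ne-ccs (λ {a} _ ne-c′ → AboveMax-++⁺ {a = a} ne-c′) linked)
    covered : ∀ {x} → x ∈ ⊤ → Any (x ∈_) (joinTop (b ∷ bs))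
    covered {x} _ with split↑ (suc m) x
    ... | inj₂ (j , refl) = here (∈-↑ʳ-++⁺ b ∈⊤)
    ... | inj₁ (i , refl) with covers {i} ∈⊤
    ...   | here i∈b   = here (∈-↑ˡ-++⁺ b i∈b)
    ...   | there i∈bs = there (Any.map⁺ (Any.map (∈-↑ˡ-++⁺ _) i∈bs))

  StrictΠ-joinTop⇒ListΠ : ∀ {bs} → StrictΠ d ⊤ (joinTop {d = d} bs) → ListΠ d (suc m) bs
  StrictΠ-joinTop⇒ListΠ {[]} (mkPartition _ _ covers _ _ , _) with covers {zero} ∈⊤
  ... | ()
  StrictΠ-joinTop⇒ListΠ {b ∷ bs} (π@(mkPartition (_ ∷ ne-bs) _ covers (b∩bs=∅ ∷ disjoint) (b<bs ∷ ordered)) , linked) =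
    mkPartition ((zero , ∈-↑ˡ-++⁻ b (zero∈firstBlock π)) ∷ All.map Nonempty-++⊥⁻ (All.map⁻ ne-bs))
                (All.universal (λ _ {x} → ⊆⊤ {x = x}) _)
                covered
                (All.map Disjoint-++⁻ (All.map⁻ b∩bs=∅) ∷ AllPairs.map Disjoint-++⁻ (AllPairs.map⁻ disjoint))
                (All.map MinBefore-++⁻ (All.map⁻ b<bs) ∷ AllPairs.map MinBefore-++⁻ (AllPairs.map⁻ ordered)) ,
    Linked.map (λ {a} → AboveMax-++⊥⁻ {a = a}) (Linked.map⁻ (Linked.tail linked))
    where
    covered : ∀ {i} → i ∈ ⊤ → Any (i ∈_) (b ∷ bs)
    covered {i} _ with covers {i ↑ˡ d} ∈⊤
    ... | here i∈b   = here (∈-↑ˡ-++⁻ b i∈b)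
    ... | there i∈bs = there (Any.map (∈-↑ˡ-++⁻ _) (Any.map⁻ i∈bs))

  -- Every block after the first lies below the top d elements, so those all belong to the first block.
  StrictΠ⇒joinTop : ∀ cs → StrictΠ d ⊤ cs → joinTop {d = d} (dropTop {suc m} cs) ≡ cs
  StrictΠ⇒joinTop []       _ = refl
  StrictΠ⇒joinTop (a ∷ cs) (mkPartition _ _ covers _ _ , linked) =
    cong₂ _∷_ (take-++⊤ a topInFirst)
              (trans (sym (map-∘ cs)) (map-id-local (All.map (take-++⊥ _) (laterBelowTop cs linked))))
    where
    notBelow : ∀ j → ¬ (d + suc (toℕ (suc m ↑ʳ j)) ≤ suc m + d)
    notBelow j below = <-irrefl refl (begin-strict
      suc m + d                    ≡⟨ +-comm (suc m) d ⟩
      d + suc m                    ≤⟨ +-monoʳ-≤ d (m≤m+n (suc m) (toℕ j)) ⟩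
      d + (suc m + toℕ j)          <⟨ +-monoʳ-< d (n<1+n _) ⟩
      d + suc (suc m + toℕ j)      ≡⟨ cong (λ t → d + suc t) (sym (toℕ-↑ʳ (suc m) j)) ⟩
      d + suc (toℕ (suc m ↑ʳ j))   ≤⟨ below ⟩
      suc m + d                    ∎)
      where open ≤-Reasoning
    laterBelowTop : ∀ {b} cs → Linked (AboveMax d) (b ∷ cs) → All (λ c → ∀ j → suc m ↑ʳ j ∉ c) cs
    laterBelowTop []       _             = []
    laterBelowTop {b} (c ∷ cs) (b>c ∷ linked) =
      (λ j j∈c → notBelow j (AboveMax⇒below {a = b} b>c j∈c)) ∷ laterBelowTop cs linked
    topInFirst : ∀ j → suc m ↑ʳ j ∈ a
    topInFirst j with covers {suc m ↑ʳ j} ∈⊤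
    ... | here j∈a   = j∈a
    ... | there j∈cs = ⊥-elim (All.lookupWith (λ notTop j∈c → notTop j j∈c) (laterBelowTop cs linked) j∈cs)

-- The recurrence

module _ (Bd : ℕ → ℕ) {d k : ℕ} where

  Bext-small : k ≤ suc d → Bext Bd d k ≡ 1
  Bext-small k≤1+d = cong (λ b → if b then 1 else Bd (k ∸ d)) (Equivalence.to T-≡ (≤⇒≤ᵇ k≤1+d))

  Bext-large : ¬ k ≤ suc d → Bext Bd d k ≡ Bd (k ∸ d)
  Bext-large k≰1+d = cong (λ b → if b then 1 else Bd (k ∸ d)) (¬-not (k≰1+d ∘ ≤ᵇ⇒≤ k (suc d) ∘ Equivalence.from T-≡))

module _ (B : ℕ → ℕ → ℕ) (isCount : ∀ d n → IsCount {List (Subset n)} (InΠ d n) (B d n)) where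

  IsCount-ListΠ : ∀ d n → IsCount (ListΠ d n) (B d n)
  IsCount-ListΠ d n = IsCount-⇔ (isCount d n) (λ _ → InΠ⇒ListΠ) (λ _ → ListΠ⇒InΠ)

  IsCount-StrictΠ-small : ∀ d k → k ≤ suc d → IsCount (StrictΠ d (⊤ {k})) 1
  IsCount-StrictΠ-small d k k≤1+d =
    trivialPartition k ∷ [] , [] ∷ [] ,
    (λ cs → mk⇔ (λ { (here refl) → StrictΠ-trivialPartition d k }) (here ∘ StrictΠ-small d k cs k≤1+d)) ,
    refl

  IsCount-StrictΠ-large : ∀ d m → IsCount (StrictΠ d (⊤ {suc m + d})) (B d (suc m))
  IsCount-StrictΠ-large d m =
    IsCount-transport (IsCount-ListΠ d (suc m)) joinTop dropTop
      (λ _ → ListΠ⇒StrictΠ-joinTop)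
      (λ cs π → StrictΠ-joinTop⇒ListΠ (subst (StrictΠ d ⊤) (sym (StrictΠ⇒joinTop cs π)) π))
      dropTop-joinTop StrictΠ⇒joinTop

  IsCount-StrictΠ : ∀ d k → IsCount (StrictΠ d (⊤ {k})) (Bext (B d) d k)
  IsCount-StrictΠ d k with k ≤? suc d
  ... | yes k≤1+d = subst (IsCount _) (sym (Bext-small (B d) k≤1+d)) (IsCount-StrictΠ-small d k k≤1+d)
  ... | no  k≰1+d = subst (IsCount _) (sym (Bext-large (B d) k≰1+d)) (aboveSmall k (≰⇒> k≰1+d))
    where
    aboveSmall : ∀ k → suc d < k → IsCount (StrictΠ d (⊤ {k})) (B d (k ∸ d))
    aboveSmall k 1+d<k with k ∸ d | m∸n+n≡m {k} {d} (≤-trans (n≤1+n d) (<⇒≤ 1+d<k))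
    ... | suc m | refl = IsCount-StrictΠ-large d m
    ... | zero  | refl = ⊥-elim (<-irrefl refl (<-trans (n<1+n d) 1+d<k))

  IsCount-StrictΠ∁ : ∀ d {n} (s : Subset n) → IsCount (StrictΠ d (∁ s)) (Bext (B d) d ∣ ∁ s ∣)
  IsCount-StrictΠ∁ d s =
    IsCount-transport (IsCount-StrictΠ d ∣ ∁ s ∣) (List.map (expand s)) (List.map (compress s))
      (λ _ → StrictΠ-expand s {d}) (λ _ → StrictΠ-compress⁺ s {d})
      (map-compress-expand s) (λ _ (π , _) → map-expand-compress s (Partition.⊆u π))

  IsCount-InΠ-suc : ∀ d n → IsCount (InΠ d (suc n)) (sum (List.map (Bext (B d) d ∘ ∣_∣ ∘ ∁) (allSubsets n)))
  IsCount-InΠ-suc d n =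
    IsCount-⇔ (IsCount-Built (λ s → StrictΠ d (∁ s)) withFirstBlock (λ s → Bext (B d) d ∣ ∁ s ∣)
                             (IsCount-StrictΠ∁ d) withFirstBlock-injectiveˡ withFirstBlock-injectiveʳ
                             (allSubsets n) (allSubsets-unique n))
              (λ { _ (s , _ , ts , π , refl) → ListΠ⇒InΠ (ListΠ-withFirstBlock⁺ s ts π) })
              (λ bs π → split bs (InΠ⇒ListΠ π))
    where
    split : ∀ bs → ListΠ d (suc n) bs → Built (λ s → StrictΠ d (∁ s)) withFirstBlock (allSubsets n) bs
    split bs π with ListΠ⇒withFirstBlock bs π
    ... | s , ts , refl = s , ∈-allSubsets s , ts , ListΠ-withFirstBlock⁻ s ts π , refl

  B-recurrence : ∀ d n → B d (suc n) ≡ binomialSum n (Bext (B d) d)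
  B-recurrence d n = trans (IsCount-unique (isCount d (suc n)) (IsCount-InΠ-suc d n)) (sum-allSubsets n (Bext (B d) d))

mainTheorem5 : (B : ℕ → ℕ → ℕ) →
               (∀ d n → IsCount {List (Subset n)} (InΠ d n) (B d n)) →
               (∀ d n → 1 ≤ n → B d n ≡ recSum (B d) d n)
               × (∀ n → 1 ≤ n → Σ ℕ λ D → ∀ d → D ≤ d → B d n ≡ 2 ^ (n ∸ 1))
mainTheorem5 B isCount = recurrence , eventuallyPowerOfTwo
  where
  recurrence : ∀ d n → 1 ≤ n → B d n ≡ recSum (B d) d n
  recurrence d (suc n) _ = trans (B-recurrence B isCount d n) (sym (sum-map-upTo (suc n) (λ k → (n C k) * Bext (B d) d k)))
  eventuallyPowerOfTwo : ∀ n → 1 ≤ n → Σ ℕ λ D → ∀ d → D ≤ d → B d n ≡ 2 ^ (n ∸ 1)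
  eventuallyPowerOfTwo (suc n) _ = n , λ d n≤d → begin
    B d (suc n)                   ≡⟨ B-recurrence B isCount d n ⟩
    binomialSum n (Bext (B d) d)  ≡⟨ binomialSum-cong n (λ k k≤n → Bext-small (B d) (≤-trans k≤n (m≤n⇒m≤1+n n≤d))) ⟩
    binomialSum n (const 1)       ≡⟨ binomialSum-one n ⟩
    2 ^ n                         ∎
    where open ≡-Reasoning
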